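{- Let $n$ be an even positive integer, and let $C$ be the $2n$-cycle in $Q_n$ with initial vertex $\emptyset$ and edge direction sequence $(1,2,\ldots,n,1,2,\ldots,n)$. Let $\mathcal G=\{\sigma_A : A\subseteq\{1,2,\ldots,n-1\},\ |A| \text{ even}\}$. Then the images $g(E(C))$, $g\in\mathcal G$, form an edge decomposition (partition of the edge set) of $Q_n$. In particular $E(C)$ is a fundamental set for $Q_n$.
   Context: $Q_n$ is the $n$-dimensional hypercube: vertex set the subsets of $\{1,\ldots,n\}$, with $x,y$ adjacent iff $|x\,\Delta\, y|=1$; an edge $\langle x,y\rangle$ has direction $i$ if $x\,\Delta\,y=\{i\}$. A walk is described by its starting vertex and the sequence of directions of its successive edges (so from vertex $x$, a step in direction $i$ goes to $x\,\Delta\,\{i\}$). For $A\subseteq\{1,\ldots,n\}$, $\sigma_A$ is the automorphism of $Q_n$ given by $\sigma_A(x)=A\,\Delta\, x$. A fundamental set of edges of a graph $G$ is a subset of $E(G)$ whose translates under some subgroup of $\mathrm{Aut}(G)$ partition $E(G)$. -}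

module Defs where

open import Data.Bool using (Bool; _xor_)
open import Data.Nat using (ℕ)
open import Data.Fin using (Fin)
open import Data.Fin.Subset using (Subset; ⁅_⁆)
open import Data.Vec using (zipWith)
open import Data.List using (List; []; _∷_; map; _++_)
open import Data.List.Relation.Unary.Any using (Any)
open import Data.Product using (_×_; _,_)
open import Data.Sum using (_⊎_)
open import Relation.Binary.PropositionalEquality using (_≡_)

-- Vertices of Q_n are subsets of the n directions; direction k+1 of the
-- paper is represented by (k : Fin n) (0-indexed).

_Δ_ : ∀ {n} → Subset n → Subset n → Subset n
_Δ_ = zipWith _xor_

HasDirection : ∀ {n} → Subset n → Subset n → Fin n → Set
HasDirection x y i = x Δ y ≡ ⁅ i ⁆

-- an (oriented representative of an) edge
Edge : ℕ → Set
Edge n = Subset n × Subset n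

walkEdges : ∀ {n} → Subset n → List (Fin n) → List (Edge n)
walkEdges x [] = []
walkEdges x (i ∷ is) = (x , x Δ ⁅ i ⁆) ∷ walkEdges (x Δ ⁅ i ⁆) is

_∈ᴱ_ : ∀ {n} → Edge n → List (Edge n) → Set
(x , y) ∈ᴱ es = Any (λ { (a , b) → (a ≡ x × b ≡ y) ⊎ (a ≡ y × b ≡ x) }) es

σ : ∀ {n} → Subset n → Subset n → Subset n
σ A x = A Δ x

σEdges : ∀ {n} → Subset n → List (Edge n) → List (Edge n)
σEdges A = map (λ { (a , b) → (σ A a , σ A b) })

cycleDirs : (n : ℕ) → List (Fin n)
cycleDirs n = Data.List.allFin n ++ Data.List.allFin n

cycleEdges : (n : ℕ) → List (Edge n)
cycleEdges n = walkEdges Data.Fin.Subset.⊥ (cycleDirs n)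

module Submission where

-- The cycle C traverses the directions 0,…,n-1 twice, starting at ∅: its
-- vertices are the prefixes P_k = {0,…,k-1} and their complements ⊤ Δ P_k,
-- and its two edges of direction i start at  rep c Δ P_i  (c ∈ {∅,⊤}).
-- Hence an edge {x,y} of direction i lies on the translate σ_B(C) iff σ_B
-- sends one of these two start vertices to x or to y, i.e. iff
--     B = (pick e x y Δ P_i) Δ rep c     for some e, c ∈ Bool.
-- Among these four sets exactly one lies in 𝒢 (even, avoiding the last
-- direction): for even n the set ⊤ is even, so the parity of B is decided
-- by e alone, and then the last coordinate of B is decided by c alone.

open import Data.Nat using (ℕ; zero; suc; _*_; _<_; _∸_)
open import Data.Nat.Divisibility using (_∣_; divides; _∣0; ∣-refl; ∣m∣n⇒∣m+n)
open import Data.Nat.Properties using (≤∧≢⇒<; <-irrefl)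
open import Data.Fin using (Fin; toℕ; fromℕ) renaming (zero to fzero; suc to fsuc)
open import Data.Fin.Properties using (toℕ-fromℕ; toℕ-injective; toℕ≤pred[n])
open import Data.Fin.Subset using (Subset; _∈_; ∣_∣; ⊥; ⊤; ⁅_⁆)
open import Data.Fin.Subset.Properties using (x∈⁅x⁆; x∈⁅y⁆⇒x≡y)
open import Data.Bool using (Bool; true; false; not; _xor_)
open import Data.Bool.Properties
  using (xor-assoc; xor-comm; xor-identityˡ; xor-identityʳ; xor-same; not-involutive)
open import Data.Vec using ([]; _∷_; replicate; lookup)
open import Data.Vec.Properties
  using (zipWith-assoc; zipWith-comm; zipWith-identityˡ; zipWith-identityʳ;
         lookup-zipWith; lookup-replicate; []=⇒lookup; lookup⇒[]=)
open import Data.List using (List; []; _∷_; map; _++_; tabulate; allFin)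
open import Data.List.Properties using (map-tabulate; tabulate-cong)
import Data.List.Relation.Unary.Any.Properties as Any
open import Data.Product using (Σ; _×_; _,_)
open import Data.Sum using (_⊎_; inj₁; inj₂)
open import Data.Empty using (⊥-elim)
open import Relation.Nullary using (¬_)
open import Relation.Binary.PropositionalEquality
  using (_≡_; refl; sym; trans; cong; cong₂; subst)
open Relation.Binary.PropositionalEquality.≡-Reasoning
open import Defs

Δ-assoc : ∀ {n} (a b c : Subset n) → (a Δ b) Δ c ≡ a Δ (b Δ c)
Δ-assoc = zipWith-assoc xor-assoc

Δ-comm : ∀ {n} (a b : Subset n) → a Δ b ≡ b Δ a
Δ-comm = zipWith-comm xor-comm

Δ-identityˡ : ∀ {n} (a : Subset n) → ⊥ Δ a ≡ a
Δ-identityˡ = zipWith-identityˡ xor-identityˡ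

Δ-identityʳ : ∀ {n} (a : Subset n) → a Δ ⊥ ≡ a
Δ-identityʳ = zipWith-identityʳ xor-identityʳ

Δ-self : ∀ {n} (a : Subset n) → a Δ a ≡ ⊥
Δ-self [] = refl
Δ-self (b ∷ a) = cong₂ _∷_ (xor-same b) (Δ-self a)

Δ-cancelˡ : ∀ {n} (a b : Subset n) → a Δ (a Δ b) ≡ b
Δ-cancelˡ a b = begin
  a Δ (a Δ b)  ≡⟨ Δ-assoc a a b ⟨
  (a Δ a) Δ b  ≡⟨ cong (_Δ b) (Δ-self a) ⟩
  ⊥ Δ b        ≡⟨ Δ-identityˡ b ⟩
  b            ∎

Δ-cancelʳ : ∀ {n} (a b : Subset n) → (a Δ b) Δ b ≡ a
Δ-cancelʳ a b = begin
  (a Δ b) Δ b  ≡⟨ Δ-assoc a b b ⟩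
  a Δ (b Δ b)  ≡⟨ cong (a Δ_) (Δ-self b) ⟩
  a Δ ⊥        ≡⟨ Δ-identityʳ a ⟩
  a            ∎

Δ-solveˡ : ∀ {n} {a b c : Subset n} → a Δ b ≡ c → b ≡ a Δ c
Δ-solveˡ {a = a} {b} eq = trans (sym (Δ-cancelˡ a b)) (cong (a Δ_) eq)

Δ-solveʳ : ∀ {n} {a b c : Subset n} → a Δ b ≡ c → a ≡ c Δ b
Δ-solveʳ {a = a} {b} eq = trans (sym (Δ-cancelʳ a b)) (cong (_Δ b) eq)

Δ-translate : ∀ {n} (b u v : Subset n) → (b Δ u) Δ (b Δ v) ≡ u Δ v
Δ-translate b u v = begin
  (b Δ u) Δ (b Δ v)  ≡⟨ cong (_Δ (b Δ v)) (Δ-comm b u) ⟩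
  (u Δ b) Δ (b Δ v)  ≡⟨ Δ-assoc u b (b Δ v) ⟩
  u Δ (b Δ (b Δ v))  ≡⟨ cong (u Δ_) (Δ-cancelˡ b v) ⟩
  u Δ v              ∎

singleton-injective : ∀ {n} {k i : Fin n} → ⁅ k ⁆ ≡ ⁅ i ⁆ → k ≡ i
singleton-injective {k = k} {i} eq = x∈⁅y⁆⇒x≡y i (subst (k ∈_) eq (x∈⁅x⁆ k))

Carries : ∀ {n} → Subset n → Subset n → Subset n → Subset n → Subset n → Set
Carries B u t x y = (B Δ u ≡ x) × (B Δ (u Δ t) ≡ y)

carries-elim : ∀ {n} {B u t x y : Subset n} → Carries B u t x y → (B ≡ x Δ u) × (t ≡ x Δ y)
carries-elim {B = B} {u} {t} {x} {y} (hx , hy) = Δ-solveʳ hx , sym xΔy≡t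
  where
  xΔy≡t : x Δ y ≡ t
  xΔy≡t = begin
    x Δ y                    ≡⟨ cong₂ _Δ_ hx hy ⟨
    (B Δ u) Δ (B Δ (u Δ t))  ≡⟨ Δ-translate B u (u Δ t) ⟩
    u Δ (u Δ t)              ≡⟨ Δ-cancelˡ u t ⟩
    t                        ∎

carries-intro : ∀ {n} (x u y : Subset n) → Carries (x Δ u) u (x Δ y) x y
carries-intro x u y = Δ-cancelʳ x u , (begin
  (x Δ u) Δ (u Δ (x Δ y))  ≡⟨ Δ-assoc x u (u Δ (x Δ y)) ⟩
  x Δ (u Δ (u Δ (x Δ y)))  ≡⟨ cong (x Δ_) (Δ-cancelˡ u (x Δ y)) ⟩
  x Δ (x Δ y)              ≡⟨ Δ-cancelˡ x y ⟩
  y                        ∎)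

Joins : ∀ {n} → Subset n → Subset n → Subset n → Subset n → Subset n → Set
Joins B x y u t = Carries B u t x y ⊎ Carries B u t y x

pick : ∀ {n} → Bool → Subset n → Subset n → Subset n
pick false x y = x
pick true  x y = y

joins-elim : ∀ {n} {B x y u : Subset n} {i k : Fin n} → x Δ y ≡ ⁅ i ⁆ →
  Joins B x y u ⁅ k ⁆ → (k ≡ i) × Σ Bool (λ e → B ≡ pick e x y Δ u)
joins-elim hxy (inj₁ carries) with carries-elim carries
... | B≡ , k≡ = singleton-injective (trans k≡ hxy) , false , B≡
joins-elim {x = x} {y} hxy (inj₂ carries) with carries-elim carries
... | B≡ , k≡ = singleton-injective (trans k≡ (trans (Δ-comm y x) hxy)) , true , B≡

joins-intro : ∀ {n} {x y : Subset n} {i : Fin n} (u : Subset n) → x Δ y ≡ ⁅ i ⁆ →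
  (e : Bool) → Joins (pick e x y Δ u) x y u ⁅ i ⁆
joins-intro {x = x} {y} u hxy false = inj₁ (subst (λ t → Carries (x Δ u) u t x y) hxy (carries-intro x u y))
joins-intro {x = x} {y} u hxy true  =
  inj₂ (subst (λ t → Carries (y Δ u) u t y x) (trans (Δ-comm y x) hxy) (carries-intro y u x))

-- P_k = {0,…,k-1}: the vertex reached from ∅ after the directions 0,…,k-1
prefix : ∀ {n} → Fin n → Subset n
prefix {suc n} fzero    = ⊥
prefix {suc n} (fsuc k) = true ∷ prefix k

-- the edge of direction k traversed when walking 0,1,…,n-1 from s
edgeFrom : ∀ {n} → Subset n → Fin n → Edge n
edgeFrom s k = (s Δ prefix k , (s Δ prefix k) Δ ⁅ k ⁆)

walkEnd : ∀ {n} → Subset n → List (Fin n) → Subset n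
walkEnd x []       = x
walkEnd x (i ∷ is) = walkEnd (x Δ ⁅ i ⁆) is

walkEdges-++ : ∀ {n} (x : Subset n) (l₁ l₂ : List (Fin n)) →
  walkEdges x (l₁ ++ l₂) ≡ walkEdges x l₁ ++ walkEdges (walkEnd x l₁) l₂
walkEdges-++ x []       l₂ = refl
walkEdges-++ x (i ∷ l₁) l₂ = cong (_ ∷_) (walkEdges-++ (x Δ ⁅ i ⁆) l₁ l₂)

liftEdge : ∀ {n} → Bool → Edge n → Edge (suc n)
liftEdge b (u , v) = (b ∷ u , b ∷ v)

walkEdges-fsuc : ∀ {n} b (x : Subset n) (is : List (Fin n)) →
  walkEdges (b ∷ x) (map fsuc is) ≡ map (liftEdge b) (walkEdges x is)
walkEdges-fsuc b x []       = refl
walkEdges-fsuc b x (i ∷ is) rewrite xor-identityʳ b = cong (_ ∷_) (walkEdges-fsuc b (x Δ ⁅ i ⁆) is)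

walkEnd-fsuc : ∀ {n} b (x : Subset n) (is : List (Fin n)) →
  walkEnd (b ∷ x) (map fsuc is) ≡ b ∷ walkEnd x is
walkEnd-fsuc b x []       = refl
walkEnd-fsuc b x (i ∷ is) rewrite xor-identityʳ b = walkEnd-fsuc b (x Δ ⁅ i ⁆) is

allFin-suc : ∀ n → tabulate {n = n} fsuc ≡ map fsuc (allFin n)
allFin-suc n = sym (map-tabulate (λ k → k) fsuc)

walkEdges-allFin : ∀ n (x : Subset n) → walkEdges x (allFin n) ≡ tabulate (edgeFrom x)
walkEdges-allFin zero    [] = refl
walkEdges-allFin (suc m) (b ∷ x) =
  cong₂ _∷_ (cong (λ z → (z , z Δ ⁅ fzero ⁆)) (sym (Δ-identityʳ (b ∷ x)))) (begin
    walkEdges (b' ∷ (x Δ ⊥)) (tabulate fsuc)        ≡⟨ cong (λ z → walkEdges (b' ∷ z) (tabulate fsuc)) (Δ-identityʳ x) ⟩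
    walkEdges (b' ∷ x) (tabulate fsuc)              ≡⟨ cong (walkEdges (b' ∷ x)) (allFin-suc m) ⟩
    walkEdges (b' ∷ x) (map fsuc (allFin m))        ≡⟨ walkEdges-fsuc b' x (allFin m) ⟩
    map (liftEdge b') (walkEdges x (allFin m))      ≡⟨ cong (map (liftEdge b')) (walkEdges-allFin m x) ⟩
    map (liftEdge b') (tabulate (edgeFrom x))       ≡⟨ map-tabulate (edgeFrom x) (liftEdge b') ⟩
    tabulate (λ k → liftEdge b' (edgeFrom x k))     ≡⟨ tabulate-cong lifted ⟩
    tabulate (λ k → edgeFrom (b ∷ x) (fsuc k))      ∎)
  where
  b' : Bool
  b' = b xor true
  lifted : ∀ k → liftEdge b' (edgeFrom x k) ≡ edgeFrom (b ∷ x) (fsuc k)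
  lifted k rewrite xor-identityʳ b' = refl

walkEnd-allFin : ∀ n (x : Subset n) → walkEnd x (allFin n) ≡ x Δ ⊤
walkEnd-allFin zero    [] = refl
walkEnd-allFin (suc m) (b ∷ x) = begin
  walkEnd (b' ∷ (x Δ ⊥)) (tabulate fsuc)    ≡⟨ cong (λ z → walkEnd (b' ∷ z) (tabulate fsuc)) (Δ-identityʳ x) ⟩
  walkEnd (b' ∷ x) (tabulate fsuc)          ≡⟨ cong (walkEnd (b' ∷ x)) (allFin-suc m) ⟩
  walkEnd (b' ∷ x) (map fsuc (allFin m))    ≡⟨ walkEnd-fsuc b' x (allFin m) ⟩
  b' ∷ walkEnd x (allFin m)                 ≡⟨ cong (b' ∷_) (walkEnd-allFin m x) ⟩
  b' ∷ (x Δ ⊤)                              ∎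
  where
  b' : Bool
  b' = b xor true

rep : ∀ {n} → Bool → Subset n
rep {n} c = replicate n c

cycleEdges-halves : ∀ n → cycleEdges n ≡ tabulate (edgeFrom (rep false)) ++ tabulate (edgeFrom (rep true))
cycleEdges-halves n = begin
  walkEdges ⊥ (allFin n ++ allFin n)
    ≡⟨ walkEdges-++ ⊥ (allFin n) (allFin n) ⟩
  walkEdges ⊥ (allFin n) ++ walkEdges (walkEnd ⊥ (allFin n)) (allFin n)
    ≡⟨ cong (λ z → walkEdges ⊥ (allFin n) ++ walkEdges z (allFin n)) (trans (walkEnd-allFin n ⊥) (Δ-identityˡ ⊤)) ⟩
  walkEdges ⊥ (allFin n) ++ walkEdges ⊤ (allFin n)
    ≡⟨ cong₂ _++_ (walkEdges-allFin n ⊥) (walkEdges-allFin n ⊤) ⟩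
  tabulate (edgeFrom (rep false)) ++ tabulate (edgeFrom (rep true)) ∎

onTranslate-elim : ∀ {n} (B x y : Subset n) → (x , y) ∈ᴱ σEdges B (cycleEdges n) →
  Σ Bool λ c → Σ (Fin n) λ k → Joins B x y (rep c Δ prefix k) ⁅ k ⁆
onTranslate-elim {n} B x y mem
  with Any.++⁻ (tabulate (edgeFrom (rep false)))
         (Any.map⁻ (subst (λ es → (x , y) ∈ᴱ σEdges B es) (cycleEdges-halves n) mem))
... | inj₁ first  = let (k , j) = Any.tabulate⁻ first  in false , k , j
... | inj₂ second = let (k , j) = Any.tabulate⁻ second in true , k , j

onTranslate-intro : ∀ {n} (B x y : Subset n) (c : Bool) (k : Fin n) →
  Joins B x y (rep c Δ prefix k) ⁅ k ⁆ → (x , y) ∈ᴱ σEdges B (cycleEdges n)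
onTranslate-intro {n} B x y false k j =
  subst (λ es → (x , y) ∈ᴱ σEdges B es) (sym (cycleEdges-halves n))
    (Any.map⁺ (Any.++⁺ˡ (Any.tabulate⁺ k j)))
onTranslate-intro {n} B x y true k j =
  subst (λ es → (x , y) ∈ᴱ σEdges B es) (sym (cycleEdges-halves n))
    (Any.map⁺ (Any.++⁺ʳ (tabulate (edgeFrom (rep false))) (Any.tabulate⁺ k j)))

shift : ∀ {n} → Subset n → Subset n → Fin n → Bool → Bool → Subset n
shift x y i e c = (pick e x y Δ prefix i) Δ rep c

Δ-rearrange : ∀ {n} (a r p : Subset n) → a Δ (r Δ p) ≡ (a Δ p) Δ r
Δ-rearrange a r p = trans (cong (a Δ_) (Δ-comm r p)) (sym (Δ-assoc a p r))

onTranslate⇒shift : ∀ {n} {B x y : Subset n} {i : Fin n} → x Δ y ≡ ⁅ i ⁆ →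
  (x , y) ∈ᴱ σEdges B (cycleEdges n) → Σ Bool λ e → Σ Bool λ c → B ≡ shift x y i e c
onTranslate⇒shift {B = B} {x} {y} hxy mem with onTranslate-elim B x y mem
... | c , k , j with joins-elim hxy j
...   | refl , e , B≡ = e , c , trans B≡ (Δ-rearrange (pick e x y) (rep c) (prefix k))

shift⇒onTranslate : ∀ {n} {x y : Subset n} {i : Fin n} → x Δ y ≡ ⁅ i ⁆ →
  (e c : Bool) → (x , y) ∈ᴱ σEdges (shift x y i e c) (cycleEdges n)
shift⇒onTranslate {n} {x} {y} {i} hxy e c =
  subst (λ B → (x , y) ∈ᴱ σEdges B (cycleEdges n)) (Δ-rearrange (pick e x y) (rep c) (prefix i))
    (onTranslate-intro _ x y c i (joins-intro (rep c Δ prefix i) hxy e))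

xor≡false⇒≡ : ∀ {a b} → a xor b ≡ false → a ≡ b
xor≡false⇒≡ {false} {false} _ = refl
xor≡false⇒≡ {true}  {true}  _ = refl

par : ∀ {n} → Subset n → Bool
par []      = false
par (b ∷ A) = b xor par A

par-Δ : ∀ {n} (A B : Subset n) → par (A Δ B) ≡ par A xor par B
par-Δ [] [] = refl
par-Δ (a ∷ A) (b ∷ B) = begin
  (a xor b) xor par (A Δ B)        ≡⟨ cong ((a xor b) xor_) (par-Δ A B) ⟩
  (a xor b) xor (par A xor par B)  ≡⟨ xor-assoc a b (par A xor par B) ⟩
  a xor (b xor (par A xor par B))  ≡⟨ cong (a xor_) (xor-assoc b (par A) (par B)) ⟨
  a xor ((b xor par A) xor par B)  ≡⟨ cong (λ z → a xor (z xor par B)) (xor-comm b (par A)) ⟩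
  a xor ((par A xor b) xor par B)  ≡⟨ cong (a xor_) (xor-assoc (par A) b (par B)) ⟩
  a xor (par A xor (b xor par B))  ≡⟨ xor-assoc a (par A) (b xor par B) ⟨
  (a xor par A) xor (b xor par B)  ∎

par-⊥ : ∀ n → par (⊥ {n}) ≡ false
par-⊥ zero    = refl
par-⊥ (suc n) = par-⊥ n

par-⁅⁆ : ∀ {n} (i : Fin n) → par ⁅ i ⁆ ≡ true
par-⁅⁆ {suc n} fzero    = cong not (par-⊥ n)
par-⁅⁆         (fsuc i) = par-⁅⁆ i

par-rep : ∀ {n} (c : Bool) → 2 ∣ n → par (rep {n} c) ≡ false
par-rep c (divides q refl) = double q
  where
  double : ∀ q → par (rep {q * 2} c) ≡ false
  double zero    = refl
  double (suc q) = begin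
    c xor (c xor par (rep {q * 2} c))  ≡⟨ xor-assoc c c (par (rep {q * 2} c)) ⟨
    (c xor c) xor par (rep {q * 2} c)  ≡⟨ cong (_xor par (rep {q * 2} c)) (xor-same c) ⟩
    par (rep {q * 2} c)                ≡⟨ double q ⟩
    false                              ∎

par-pick : ∀ {n} {x y : Subset n} {i : Fin n} → x Δ y ≡ ⁅ i ⁆ →
  (e : Bool) → par (pick e x y) ≡ e xor par x
par-pick hxy false = refl
par-pick {x = x} {y} {i} hxy true = begin
  par y               ≡⟨ cong par (Δ-solveˡ hxy) ⟩
  par (x Δ ⁅ i ⁆)     ≡⟨ par-Δ x ⁅ i ⁆ ⟩
  par x xor par ⁅ i ⁆ ≡⟨ cong (par x xor_) (par-⁅⁆ i) ⟩
  par x xor true      ≡⟨ xor-comm (par x) true ⟩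
  true xor par x      ∎

par-shift : ∀ {n} {x y : Subset n} {i : Fin n} → 2 ∣ n → x Δ y ≡ ⁅ i ⁆ →
  (e c : Bool) → par (shift x y i e c) ≡ e xor (par x xor par (prefix i))
par-shift {n} {x} {y} {i} 2∣n hxy e c = begin
  par ((pick e x y Δ prefix i) Δ rep c)           ≡⟨ par-Δ (pick e x y Δ prefix i) (rep c) ⟩
  par (pick e x y Δ prefix i) xor par (rep {n} c) ≡⟨ cong (par (pick e x y Δ prefix i) xor_) (par-rep c 2∣n) ⟩
  par (pick e x y Δ prefix i) xor false           ≡⟨ xor-identityʳ _ ⟩
  par (pick e x y Δ prefix i)                     ≡⟨ par-Δ (pick e x y) (prefix i) ⟩
  par (pick e x y) xor par (prefix i)             ≡⟨ cong (_xor par (prefix i)) (par-pick hxy e) ⟩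
  (e xor par x) xor par (prefix i)                ≡⟨ xor-assoc e (par x) (par (prefix i)) ⟩
  e xor (par x xor par (prefix i))                ∎

odd : ℕ → Bool
odd zero    = false
odd (suc m) = not (odd m)

par≡odd∣∣ : ∀ {n} (A : Subset n) → par A ≡ odd ∣ A ∣
par≡odd∣∣ []          = refl
par≡odd∣∣ (true ∷ A)  = cong not (par≡odd∣∣ A)
par≡odd∣∣ (false ∷ A) = par≡odd∣∣ A

even⇒¬odd : ∀ {m} → 2 ∣ m → odd m ≡ false
even⇒¬odd (divides zero    refl) = refl
even⇒¬odd (divides (suc q) refl) = trans (not-involutive _) (even⇒¬odd (divides q refl))

¬odd⇒even : ∀ m → odd m ≡ false → 2 ∣ m
¬odd⇒even zero          _ = 2 ∣0
¬odd⇒even (suc (suc m)) h = ∣m∣n⇒∣m+n ∣-refl (¬odd⇒even m (trans (sym (not-involutive _)) h))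

even⇒par : ∀ {n} (A : Subset n) → 2 ∣ ∣ A ∣ → par A ≡ false
even⇒par A h = trans (par≡odd∣∣ A) (even⇒¬odd h)

par⇒even : ∀ {n} (A : Subset n) → par A ≡ false → 2 ∣ ∣ A ∣
par⇒even A h = ¬odd⇒even ∣ A ∣ (trans (sym (par≡odd∣∣ A)) h)

AvoidsLast : ∀ {n} → Subset n → Set
AvoidsLast {n} A = (j : Fin n) → j ∈ A → toℕ j < n ∸ 1

avoidsLast⇒lookup : ∀ {m} (A : Subset (suc m)) → AvoidsLast A → lookup A (fromℕ m) ≡ false
avoidsLast⇒lookup {m} A avoids with lookup A (fromℕ m) in eq
... | false = refl
... | true  = ⊥-elim (<-irrefl (toℕ-fromℕ m) (avoids (fromℕ m) (lookup⇒[]= (fromℕ m) A eq)))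

lookup⇒avoidsLast : ∀ {m} (A : Subset (suc m)) → lookup A (fromℕ m) ≡ false → AvoidsLast A
lookup⇒avoidsLast {m} A last j j∈A = ≤∧≢⇒< (toℕ≤pred[n] j) j≢last
  where
  j≢last : ¬ toℕ j ≡ m
  j≢last eq with trans (sym ([]=⇒lookup j∈A))
                       (trans (cong (lookup A) (toℕ-injective (trans eq (sym (toℕ-fromℕ m))))) last)
  ... | ()

lookup-shift : ∀ {n} (x y : Subset n) (i j : Fin n) (e c : Bool) →
  lookup (shift x y i e c) j ≡ lookup (pick e x y Δ prefix i) j xor c
lookup-shift x y i j e c =
  trans (lookup-zipWith _xor_ j (pick e x y Δ prefix i) (rep c))
        (cong (lookup (pick e x y Δ prefix i) j xor_) (lookup-replicate j c))

proposition7 : (n : ℕ) → 0 < n → 2 ∣ n →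
    (x y : Subset n) (i : Fin n) → HasDirection x y i →
    Σ (Subset n) λ A →
    (((j : Fin n) → j ∈ A → toℕ j < n ∸ 1) × 2 ∣ ∣ A ∣ × (x , y) ∈ᴱ σEdges A (cycleEdges n))
    × ((B : Subset n) →
    ((j : Fin n) → j ∈ B → toℕ j < n ∸ 1) → 2 ∣ ∣ B ∣ → (x , y) ∈ᴱ σEdges B (cycleEdges n) →
    B ≡ A)
proposition7 (suc m) _ 2∣n x y i hxy =
  A , (lookup⇒avoidsLast A lastA , par⇒even A parA , shift⇒onTranslate hxy e₀ c₀) , unique
  where
  last : Fin (suc m)
  last = fromℕ m

  -- the parity condition fixes e, then the last-coordinate condition fixes c
  e₀ c₀ : Bool
  e₀ = par x xor par (prefix i)
  c₀ = lookup (pick e₀ x y Δ prefix i) last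

  A : Subset (suc m)
  A = shift x y i e₀ c₀

  parA : par A ≡ false
  parA = trans (par-shift 2∣n hxy e₀ c₀) (xor-same e₀)

  lastA : lookup A last ≡ false
  lastA = trans (lookup-shift x y i last e₀ c₀) (xor-same c₀)

  unique : (B : Subset (suc m)) → AvoidsLast B → 2 ∣ ∣ B ∣ →
    (x , y) ∈ᴱ σEdges B (cycleEdges (suc m)) → B ≡ A
  unique B avoids even mem with onTranslate⇒shift hxy mem
  ... | e , c , refl = cong₂ (shift x y i) e≡e₀ c≡c₀
    where
    e≡e₀ : e ≡ e₀
    e≡e₀ = xor≡false⇒≡ (trans (sym (par-shift 2∣n hxy e c)) (even⇒par B even))
    c≡c₀ : c ≡ c₀
    c≡c₀ = trans (sym (xor≡false⇒≡ (trans (sym (lookup-shift x y i last e c)) (avoidsLast⇒lookup B avoids))))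
                 (cong (λ e' → lookup (pick e' x y Δ prefix i) last) e≡e₀)
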